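{- Let $I$ be an independent set in a claw-free graph $G$ and let $C$ be an $I$-bad cycle. Then every shortest TS-sequence that resolves $C$ is an internal resolving sequence or an external resolving sequence.
   Context: Graphs are finite and simple; claw-free means no induced $K_{1,3}$. For $S\subseteq V(G)$, $N_i(S)=\{v\in V(G)\setminus S:|N(v)\cap S|=i\}$. A TS-sequence is a sequence $I_0,\ldots,I_m$ of independent sets such that each $I_{i+1}$ arises from $I_i$ by a move $u\to v$: $uv\in E(G)$, $I_i\setminus I_{i+1}=\{u\}$, $I_{i+1}\setminus I_i=\{v\}$; its length is $m$. A cycle $v_0,\ldots,v_k=v_0$ is $I$-bad if $|\{v_i,v_{i+1}\}\cap I|=1$ for all $i$ and $G[\{v_0,\ldots,v_{k-1}\}]$ is a cycle; its $I$-bipartition is $[A,B]=[V(C)\cap I,V(C)\setminus I]$. A TS-sequence $I_0=I,\ldots,I_m$ resolves $C$ (is a resolving sequence for $C$) if $G[I_m\cup B]$ contains no cycle. A move $u\to v$ is internal if $\{u,v\}\subseteq N_2(B)$ and external if $\{u,v\}\subseteq N_0(B)$. A resolving sequence is internal (resp. external) if every move except the last is internal (resp. external). -}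

module Defs where

open import Data.Nat using (ℕ; zero; suc; _≤_; _<_)
open import Data.Fin using (Fin; toℕ; inject₁; fromℕ) renaming (zero to fzero; suc to fsuc)
open import Data.Fin.Properties using (any?) renaming (_≟_ to _≟ᶠ_)
open import Data.Fin.Subset using (Subset; _∈_; _∉_; _∩_; _∪_; ∣_∣)
open import Data.Fin.Subset.Properties using (_∈?_)
open import Data.Vec using (tabulate)
open import Data.Bool using (Bool; _∧_; not)
open import Data.Product using (Σ; ∃; ∃₂; _×_; _,_)
open import Data.Sum using (_⊎_)
open import Data.Empty using (⊥)
open import Relation.Nullary using (¬_; Dec; does)
open import Relation.Binary using (Decidable)
open import Relation.Binary.PropositionalEquality using (_≡_; _≢_)
open import Function using (Injective; _⇔_)

record Graph : Set₁ where
  field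
    n     : ℕ
    Adj   : Fin n → Fin n → Set
    adj?  : Decidable Adj
    sym   : ∀ {u v} → Adj u v → Adj v u
    irrefl : ∀ {u} → ¬ Adj u u

module _ (G : Graph) where
  open Graph G

  Nbhd : Fin n → Subset n
  Nbhd v = tabulate (λ u → does (adj? v u))

  InN : ℕ → Subset n → Fin n → Set
  InN i S v = v ∉ S × ∣ Nbhd v ∩ S ∣ ≡ i

  Independent : Subset n → Set
  Independent I = ∀ u v → u ∈ I → v ∈ I → ¬ Adj u v

  ClawFree : Set
  ClawFree = ∀ c a b d → Adj c a → Adj c b → Adj c d →
             a ≢ b → a ≢ d → b ≢ d →
             ¬ Adj a b → ¬ Adj a d → ¬ Adj b d → ⊥

  Succ : ∀ {k} → Fin k → Fin k → Set
  Succ {k} i j = toℕ j ≡ suc (toℕ i) ⊎ (suc (toℕ i) ≡ k × toℕ j ≡ 0)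

  HasCycleIn : Subset n → Set
  HasCycleIn S = Σ ℕ λ k → 3 ≤ k × Σ (Fin k → Fin n) λ w →
    Injective _≡_ _≡_ w × (∀ i → w i ∈ S) × (∀ i j → Succ i j → Adj (w i) (w j))

  record BadCycle (I : Subset n) : Set where
    field
      len   : ℕ
      len≥3 : 3 ≤ len
      v     : Fin len → Fin n
      inj   : Injective _≡_ _≡_ v
      induced : ∀ i j → Adj (v i) (v j) ⇔ (Succ i j ⊎ Succ j i)
      alt   : ∀ i j → Succ i j →
              (v i ∈ I × v j ∉ I) ⊎ (v i ∉ I × v j ∈ I)

    B : Subset n
    B = tabulate (λ w → not (does (w ∈? I)) ∧ does (any? (λ i → v i ≟ᶠ w)))

  Move : Subset n → Subset n → Fin n → Fin n → Set
  Move I J u v = Adj u v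
               × (∀ w → (w ∈ I × w ∉ J) ⇔ (w ≡ u))
               × (∀ w → (w ∈ J × w ∉ I) ⇔ (w ≡ v))

  record TSSeq : Set where
    field
      len   : ℕ
      sets  : Fin (suc len) → Subset n
      indep : ∀ i → Independent (sets i)
      step  : (i : Fin len) → ∃₂ λ u v → Move (sets (inject₁ i)) (sets (fsuc i)) u v

    final : Subset n
    final = sets (fromℕ len)

  module _ {I : Subset n} (C : BadCycle I) where
    open BadCycle C using (B)

    Resolves : TSSeq → Set
    Resolves σ = TSSeq.sets σ fzero ≡ I × ¬ HasCycleIn (TSSeq.final σ ∪ B)

    Shortest : TSSeq → Set
    Shortest σ = Resolves σ × (∀ τ → Resolves τ → TSSeq.len σ ≤ TSSeq.len τ)

    -- every move except the last one is internal ({u,v} ⊆ N_2(B))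
    InternalSeq : TSSeq → Set
    InternalSeq σ = Resolves σ × (∀ (i : Fin (TSSeq.len σ)) → suc (toℕ i) < TSSeq.len σ →
      ∃₂ λ u v → Move (TSSeq.sets σ (inject₁ i)) (TSSeq.sets σ (fsuc i)) u v
                × InN 2 B u × InN 2 B v)

    -- every move except the last one is external ({u,v} ⊆ N_0(B))
    ExternalSeq : TSSeq → Set
    ExternalSeq σ = Resolves σ × (∀ (i : Fin (TSSeq.len σ)) → suc (toℕ i) < TSSeq.len σ →
      ∃₂ λ u v → Move (TSSeq.sets σ (inject₁ i)) (TSSeq.sets σ (fsuc i)) u v
                × InN 0 B u × InN 0 B v)

-- Follow C through the sequence.  As long as C is unresolved, the tokens that started on A = V(C) ∩ I sit
-- on vertices ρ c that form a cycle together with B; by claw-freeness each of them has exactly its two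
-- cycle-neighbours in B, and every other token has no neighbour in B.  Moving a token ρ r either resolves C
-- or goes to a common neighbour of the two B-neighbours of r (an internal move); moving any other token
-- stays inside N₀(B) (an external move).  So in a shortest resolving sequence every move but the last is
-- internal or external.  Tokens moved internally are never adjacent to tokens moved externally, so the
-- moves of either kind can be dropped.  If the last target y has a neighbour z ∈ I ∩ N₀(B), drop the
-- internal moves and finish by moving onto y a token of A adjacent to y (a second neighbour of y in
-- I \ N₀(B) would form a claw at y with z); otherwise drop the external moves and keep the last move.
-- If both kinds of moves occurred, either way resolves C sooner.

module Submission where

open import Defs
open import Data.Nat using (ℕ; zero; suc; _≤_; _<_; z≤n; s≤s; _<?_) renaming (_≟_ to _≟ℕ_)
open import Data.Nat.Properties
  using (≤-refl; ≤-reflexive; ≤-trans; <-trans; ≤-antisym; <-irrefl; ≮⇒≥; n<1+n; n≤1+n; m≤n⇒m≤1+n; ≤∧≢⇒<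
        ; <⇒≤; <⇒≱; ≤-pred; suc-injective; m≤n⇒m⊓n≡m; m⊓n≤n)
open import Data.Fin using (Fin; toℕ; inject₁; fromℕ; fromℕ<) renaming (zero to fzero; suc to fsuc)
open import Data.Fin.Properties
  using (toℕ-injective; toℕ<n; toℕ-fromℕ<; toℕ-inject₁; toℕ-fromℕ; ≤fromℕ; any?) renaming (_≟_ to _≟ᶠ_)
open import Data.Fin.Induction using (<-weakInduction; <-weakInduction-startingFrom)
open import Data.Fin.Subset using (Subset; _∈_; _∉_; _∪_; _⊆_; ∣_∣; ⁅_⁆; Nonempty; Empty)
open import Data.Fin.Subset.Properties
  using (_∈?_; x∈p∩q⁺; x∈p∩q⁻; x∈p∪q⁺; x∈p∪q⁻; ⊆-antisym; Empty-unique; ∣⊥∣≡0; ∣⁅x⁆∣≡1; x∈⁅x⁆; x∈⁅y⁆⇒x≡y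
        ; p⊆q⇒∣p∣≤∣q∣; nonempty?; ∪-identityˡ; ∪-identityʳ)
open import Data.Vec using (tabulate)
open import Data.Vec.Properties using ([]=⇒lookup; lookup⇒[]=; lookup∘tabulate)
open import Data.Vec.Functional using (updateAt)
open import Data.Vec.Functional.Properties using (updateAt-updates; updateAt-minimal)
open import Data.Product using (Σ; ∃; ∃₂; _×_; _,_; proj₁; proj₂)
open import Data.Sum using (_⊎_; inj₁; inj₂; [_,_]′) renaming (map to ⊎-map; map₂ to ⊎-map₂; swap to ⊎-swap)
open import Data.Empty using (⊥; ⊥-elim)
open import Function using (id; _∘_; mk⇔; Equivalence)
open import Relation.Nullary using (¬_; Dec; yes; no; does; contradiction)
open import Relation.Nullary.Decidable using (dec-true; decidable-stable; ¬?; _×-dec_; _⊎-dec_)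
open import Relation.Binary.PropositionalEquality

∣⁅x⁆∪⁅y⁆∣≡2 : ∀ {n} {x y : Fin n} → x ≢ y → ∣ ⁅ x ⁆ ∪ ⁅ y ⁆ ∣ ≡ 2
∣⁅x⁆∪⁅y⁆∣≡2 {x = fzero}  {fzero}  x≢y = contradiction refl x≢y
∣⁅x⁆∪⁅y⁆∣≡2 {x = fzero}  {fsuc y} _   = cong suc (trans (cong ∣_∣ (∪-identityˡ ⁅ y ⁆)) (∣⁅x⁆∣≡1 y))
∣⁅x⁆∪⁅y⁆∣≡2 {x = fsuc x} {fzero}  _   = cong suc (trans (cong ∣_∣ (∪-identityʳ ⁅ x ⁆)) (∣⁅x⁆∣≡1 x))
∣⁅x⁆∪⁅y⁆∣≡2 {x = fsuc x} {fsuc y} x≢y = ∣⁅x⁆∪⁅y⁆∣≡2 (x≢y ∘ cong fsuc)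

module _ {n : ℕ} where

  toSubset : {P : Fin n → Set} → (∀ x → Dec (P x)) → Subset n
  toSubset P? = tabulate (does ∘ P?)

  module _ {P : Fin n → Set} (P? : ∀ x → Dec (P x)) where

    ∈-toSubset⁺ : ∀ {x} → P x → x ∈ toSubset P?
    ∈-toSubset⁺ {x} px = lookup⇒[]= x _ (trans (lookup∘tabulate (does ∘ P?) x) (dec-true (P? x) px))

    ∈-toSubset⁻ : ∀ {x} → x ∈ toSubset P? → P x
    ∈-toSubset⁻ {x} x∈ with P? x | trans (sym (lookup∘tabulate (does ∘ P?) x)) ([]=⇒lookup x∈)
    ... | yes px | _ = px
    ... | no _   | ()

  x∈p⇒0<∣p∣ : ∀ {x} {p : Subset n} → x ∈ p → 0 < ∣ p ∣
  x∈p⇒0<∣p∣ {x = x} {p} x∈p =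
    subst (_≤ ∣ p ∣) (∣⁅x⁆∣≡1 x) (p⊆q⇒∣p∣≤∣q∣ (λ y∈ → subst (_∈ p) (sym (x∈⁅y⁆⇒x≡y x y∈)) x∈p))

  Empty⇒∣p∣≡0 : ∀ {p : Subset n} → Empty p → ∣ p ∣ ≡ 0
  Empty⇒∣p∣≡0 empty = trans (cong ∣_∣ (Empty-unique empty)) (∣⊥∣≡0 n)

  ∣p∣≢0⇒Nonempty : ∀ {p : Subset n} → ∣ p ∣ ≢ 0 → Nonempty p
  ∣p∣≢0⇒Nonempty {p} ∣p∣≢0 with nonempty? p
  ... | yes ne    = ne
  ... | no  empty = contradiction (Empty⇒∣p∣≡0 empty) ∣p∣≢0

  ∣p∣≡2 : ∀ {p : Subset n} {x y} → x ≢ y → x ∈ p → y ∈ p → (∀ {z} → z ∈ p → z ≡ x ⊎ z ≡ y) → ∣ p ∣ ≡ 2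
  ∣p∣≡2 {p = p} {x} {y} x≢y x∈p y∈p only = trans (cong ∣_∣ (⊆-antisym p⊆ ⊆p)) (∣⁅x⁆∪⁅y⁆∣≡2 x≢y)
    where
      p⊆ : p ⊆ ⁅ x ⁆ ∪ ⁅ y ⁆
      p⊆ z∈p with only z∈p
      ... | inj₁ refl = x∈p∪q⁺ (inj₁ (x∈⁅x⁆ x))
      ... | inj₂ refl = x∈p∪q⁺ (inj₂ (x∈⁅x⁆ y))
      ⊆p : ⁅ x ⁆ ∪ ⁅ y ⁆ ⊆ p
      ⊆p z∈ with x∈p∪q⁻ ⁅ x ⁆ ⁅ y ⁆ z∈
      ... | inj₁ z∈⁅x⁆ = subst (_∈ p) (sym (x∈⁅y⁆⇒x≡y x z∈⁅x⁆)) x∈p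
      ... | inj₂ z∈⁅y⁆ = subst (_∈ p) (sym (x∈⁅y⁆⇒x≡y y z∈⁅y⁆)) y∈p

-- Succ G does not depend on G; the parameter only matches its type.
module CyclicOrder (G : Graph) where

  private variable
    k : ℕ

  next : Fin k → Fin k
  next {suc k} i with suc (toℕ i) <? suc k
  ... | yes i+1<k = fromℕ< i+1<k
  ... | no _      = fzero

  prev : Fin k → Fin k
  prev {suc k} fzero    = fromℕ k
  prev {suc k} (fsuc i) = inject₁ i

  Succ-next : (i : Fin k) → Succ G i (next i)
  Succ-next {suc k} i with suc (toℕ i) <? suc k
  ... | yes i+1<k = inj₁ (toℕ-fromℕ< i+1<k)
  ... | no i+1≮k  = inj₂ (≤-antisym (toℕ<n i) (≮⇒≥ i+1≮k) , refl)

  Succ-prev : (i : Fin k) → Succ G (prev i) i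
  Succ-prev {suc k} fzero    = inj₂ (cong suc (toℕ-fromℕ k) , refl)
  Succ-prev {suc k} (fsuc i) = inj₁ (cong suc (sym (toℕ-inject₁ i)))

  Succ-functional : {i j j' : Fin k} → Succ G i j → Succ G i j' → j ≡ j'
  Succ-functional         (inj₁ j≡)     (inj₁ j'≡)     = toℕ-injective (trans j≡ (sym j'≡))
  Succ-functional {j = j} (inj₁ j≡)     (inj₂ (k≡ , _)) = ⊥-elim (<-irrefl (trans j≡ k≡) (toℕ<n j))
  Succ-functional {j' = j'} (inj₂ (k≡ , _)) (inj₁ j'≡)   = ⊥-elim (<-irrefl (trans j'≡ k≡) (toℕ<n j'))
  Succ-functional         (inj₂ (_ , j≡)) (inj₂ (_ , j'≡)) = toℕ-injective (trans j≡ (sym j'≡))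

  Succ-injective : {i i' j : Fin k} → Succ G i j → Succ G i' j → i ≡ i'
  Succ-injective (inj₁ j≡)       (inj₁ j≡')       = toℕ-injective (suc-injective (trans (sym j≡) j≡'))
  Succ-injective (inj₁ j≡)       (inj₂ (_ , j≡0)) with () ← trans (sym j≡) j≡0
  Succ-injective (inj₂ (_ , j≡0)) (inj₁ j≡)       with () ← trans (sym j≡) j≡0
  Succ-injective (inj₂ (i≡ , _)) (inj₂ (i≡' , _)) = toℕ-injective (suc-injective (trans i≡ (sym i≡')))

  Succ⇒≡next : {i j : Fin k} → Succ G i j → j ≡ next i
  Succ⇒≡next i→j = Succ-functional i→j (Succ-next _)

  next-prev : (i : Fin k) → next (prev i) ≡ i
  next-prev i = sym (Succ⇒≡next (Succ-prev i))

  prev-next : (i : Fin k) → prev (next i) ≡ i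
  prev-next i = Succ-injective (Succ-prev (next i)) (Succ-next i)

  cyclic-induction : (P : Fin k → Set) → (∀ i → P i → P (next i)) → ∀ {i} → P i → ∀ j → P j
  cyclic-induction {suc k} P closed {i} Pi = <-weakInduction P P0 up
    where
      up : ∀ j → P (inject₁ j) → P (fsuc j)
      up j = subst P (next-prev (fsuc j)) ∘ closed (inject₁ j)
      P0 : P fzero
      P0 = subst P (next-prev fzero) (closed _ (<-weakInduction-startingFrom P Pi up (≤fromℕ i)))

  module _ (3≤k : 3 ≤ k) where

    private
      3≰1 : ¬ 3 ≤ 1
      3≰1 (s≤s ())

      3≰2 : ¬ 3 ≤ 2
      3≰2 (s≤s (s≤s ()))

      Succ-irreflexive : {i : Fin k} → ¬ Succ G i i
      Succ-irreflexive (inj₁ i≡) = <-irrefl i≡ (n<1+n _)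
      Succ-irreflexive (inj₂ (k≡ , i≡0)) = 3≰1 (≤-trans 3≤k (≤-reflexive (trans (sym k≡) (cong suc i≡0))))

      Succ-asymmetric : {i j : Fin k} → Succ G i j → ¬ Succ G j i
      Succ-asymmetric (inj₁ j≡) (inj₁ i≡) = <-irrefl (trans i≡ (cong suc j≡)) (<-trans (n<1+n _) (n<1+n _))
      Succ-asymmetric (inj₁ j≡) (inj₂ (k≡ , i≡0)) =
        3≰2 (≤-trans 3≤k (≤-reflexive (trans (sym k≡) (cong suc (trans j≡ (cong suc i≡0))))))
      Succ-asymmetric (inj₂ (k≡ , j≡0)) (inj₁ i≡) =
        3≰2 (≤-trans 3≤k (≤-reflexive (trans (sym k≡) (cong suc (trans i≡ (cong suc j≡0))))))
      Succ-asymmetric (inj₂ (k≡ , _)) (inj₂ (_ , i≡0)) = 3≰1 (≤-trans 3≤k (≤-reflexive (trans (sym k≡) (cong suc i≡0))))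

    next≢prev : (i : Fin k) → next i ≢ prev i
    next≢prev i eq = Succ-asymmetric (Succ-next i) (subst (λ j → Succ G j i) (sym eq) (Succ-prev i))

    next≢id : (i : Fin k) → next i ≢ i
    next≢id i eq = Succ-irreflexive (subst (Succ G i) eq (Succ-next i))

module Moves (G : Graph) where
  open Graph G renaming (sym to adj-sym)

  private variable
    S S' T U : Subset n
    x y w : Fin n

  module _ (mv : Move G S S' x y) where

    Move-adj : Adj x y
    Move-adj = proj₁ mv

    Move-source : x ∈ S × x ∉ S'
    Move-source = Equivalence.from (proj₁ (proj₂ mv) x) refl

    Move-target : y ∈ S' × y ∉ S
    Move-target = Equivalence.from (proj₂ (proj₂ mv) y) refl

    Move-keeps : w ∈ S → w ≢ x → w ∈ S'
    Move-keeps {w} w∈S w≢x with w ∈? S'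
    ... | yes w∈S' = w∈S'
    ... | no  w∉S' = contradiction (Equivalence.to (proj₁ (proj₂ mv) w) (w∈S , w∉S')) w≢x

    Move-back : w ∈ S' → w ≢ y → w ∈ S
    Move-back {w} w∈S' w≢y with w ∈? S
    ... | yes w∈S = w∈S
    ... | no  w∉S = contradiction (Equivalence.to (proj₂ (proj₂ mv) w) (w∈S' , w∉S)) w≢y

  swap : Subset n → Fin n → Fin n → Subset n
  swap S a b = toSubset (λ q → (q ≟ᶠ b) ⊎-dec ((q ∈? S) ×-dec ¬? (q ≟ᶠ a)))

  module _ {S : Subset n} {a b : Fin n} where

    ∈swap⁻ : ∀ {q} → q ∈ swap S a b → q ≡ b ⊎ (q ∈ S × q ≢ a)
    ∈swap⁻ = ∈-toSubset⁻ (λ q → (q ≟ᶠ b) ⊎-dec ((q ∈? S) ×-dec ¬? (q ≟ᶠ a)))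

    ∈swap⁺ : ∀ {q} → q ≡ b ⊎ (q ∈ S × q ≢ a) → q ∈ swap S a b
    ∈swap⁺ = ∈-toSubset⁺ (λ q → (q ≟ᶠ b) ⊎-dec ((q ∈? S) ×-dec ¬? (q ≟ᶠ a)))

    swap-move : Adj a b → a ∈ S → b ∉ S → Move G S (swap S a b) a b
    swap-move ab a∈S b∉S = ab , (λ q → mk⇔ (leaves q) λ { refl → a∈S , a∉ })
                              , (λ q → mk⇔ (enters q) λ { refl → ∈swap⁺ (inj₁ refl) , b∉S })
      where
        a∉ : a ∉ swap S a b
        a∉ a∈ with ∈swap⁻ a∈
        ... | inj₁ refl     = irrefl ab
        ... | inj₂ (_ , a≢a) = a≢a refl
        leaves : ∀ q → q ∈ S × q ∉ swap S a b → q ≡ a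
        leaves q (q∈S , q∉) with q ≟ᶠ a
        ... | yes q≡a = q≡a
        ... | no  q≢a = contradiction (∈swap⁺ (inj₂ (q∈S , q≢a))) q∉
        enters : ∀ q → q ∈ swap S a b × q ∉ S → q ≡ b
        enters q (q∈ , q∉S) with ∈swap⁻ q∈
        ... | inj₁ q≡b       = q≡b
        ... | inj₂ (q∈S , _) = contradiction q∈S q∉S

    swap-independent : Independent G S → (∀ q → q ∈ S → q ≢ a → ¬ Adj b q) → Independent G (swap S a b)
    swap-independent S-ind b-free u u' u∈ u'∈ with ∈swap⁻ u∈ | ∈swap⁻ u'∈
    ... | inj₁ refl        | inj₁ refl          = irrefl
    ... | inj₁ refl        | inj₂ (u'∈S , u'≢a) = b-free u' u'∈S u'≢a
    ... | inj₂ (u∈S , u≢a) | inj₁ refl          = b-free u u∈S u≢a ∘ adj-sym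
    ... | inj₂ (u∈S , _)   | inj₂ (u'∈S , _)    = S-ind u u' u∈S u'∈S

  module Mix (Z : Fin n → Set) (Z? : ∀ x → Dec (Z x)) where

    mix : Subset n → Subset n → Subset n
    mix P Q = toSubset (λ q → (Z? q ×-dec q ∈? P) ⊎-dec (¬? (Z? q) ×-dec q ∈? Q))

    private variable
      P P' Q : Subset n

    ∈mix⁻ : ∀ {q} → q ∈ mix P Q → (Z q × q ∈ P) ⊎ (¬ Z q × q ∈ Q)
    ∈mix⁻ {P} {Q} = ∈-toSubset⁻ (λ q → (Z? q ×-dec q ∈? P) ⊎-dec (¬? (Z? q) ×-dec q ∈? Q))

    ∈mix⁺ : ∀ {q} → (Z q × q ∈ P) ⊎ (¬ Z q × q ∈ Q) → q ∈ mix P Q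
    ∈mix⁺ {P} {Q} = ∈-toSubset⁺ (λ q → (Z? q ×-dec q ∈? P) ⊎-dec (¬? (Z? q) ×-dec q ∈? Q))

    ∈mix-Z : ∀ {q} → Z q → q ∈ P → q ∈ mix P Q
    ∈mix-Z z q∈ = ∈mix⁺ (inj₁ (z , q∈))

    ∈mix-¬Z : ∀ {q} → ¬ Z q → q ∈ Q → q ∈ mix P Q
    ∈mix-¬Z ¬z q∈ = ∈mix⁺ (inj₂ (¬z , q∈))

    mix-self : mix P P ≡ P
    mix-self {P = P} = ⊆-antisym (λ q∈ → [ proj₂ , proj₂ ]′ (∈mix⁻ q∈)) within
      where
        within : P ⊆ mix P P
        within {q} q∈ with Z? q
        ... | yes z = ∈mix-Z z q∈
        ... | no ¬z = ∈mix-¬Z ¬z q∈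

    mix-move : Z x → Z y → Move G P P' x y → Move G (mix P Q) (mix P' Q) x y
    mix-move {x} {y} {P} {P'} {Q} zx zy mv =
      Move-adj mv , (λ q → mk⇔ (leaves q) λ { refl → ∈mix-Z zx (proj₁ (Move-source mv)) , x∉ })
                  , (λ q → mk⇔ (enters q) λ { refl → ∈mix-Z zy (proj₁ (Move-target mv)) , y∉ })
      where
        x∉ : x ∉ mix P' Q
        x∉ x∈ = [ proj₂ (Move-source mv) ∘ proj₂ , (λ h → proj₁ h zx) ]′ (∈mix⁻ x∈)
        y∉ : y ∉ mix P Q
        y∉ y∈ = [ proj₂ (Move-target mv) ∘ proj₂ , (λ h → proj₁ h zy) ]′ (∈mix⁻ y∈)
        leaves : ∀ q → q ∈ mix P Q × q ∉ mix P' Q → q ≡ x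
        leaves q (q∈ , q∉) with ∈mix⁻ q∈
        ... | inj₂ (¬z , q∈Q) = contradiction (∈mix-¬Z ¬z q∈Q) q∉
        ... | inj₁ (z , q∈P) with q ∈? P'
        ...   | yes q∈P' = contradiction (∈mix-Z z q∈P') q∉
        ...   | no q∉P'  = Equivalence.to (proj₁ (proj₂ mv) q) (q∈P , q∉P')
        enters : ∀ q → q ∈ mix P' Q × q ∉ mix P Q → q ≡ y
        enters q (q∈ , q∉) with ∈mix⁻ q∈
        ... | inj₂ (¬z , q∈Q) = contradiction (∈mix-¬Z ¬z q∈Q) q∉
        ... | inj₁ (z , q∈P') with q ∈? P
        ...   | yes q∈P = contradiction (∈mix-Z z q∈P) q∉
        ...   | no q∉P  = Equivalence.to (proj₂ (proj₂ mv) q) (q∈P' , q∉P)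

    mix-idle : ¬ Z x → ¬ Z y → Move G P P' x y → mix P' Q ≡ mix P Q
    mix-idle {x} {y} ¬zx ¬zy mv = ⊆-antisym (transfer (Move-back mv) ¬zy) (transfer (Move-keeps mv) ¬zx)
      where
        transfer : ∀ {R R' u} → (∀ {q} → q ∈ R → q ≢ u → q ∈ R') → ¬ Z u → mix R Q ⊆ mix R' Q
        transfer keep ¬zu q∈ with ∈mix⁻ q∈
        ... | inj₁ (z , q∈R) = ∈mix-Z z (keep q∈R (λ { refl → ¬zu z }))
        ... | inj₂ (¬z , q∈Q) = ∈mix-¬Z ¬z q∈Q

    mix-independent : Independent G P → Independent G Q →
                      (∀ a b → a ∈ P → Z a → b ∈ Q → ¬ Z b → ¬ Adj a b) → Independent G (mix P Q)
    mix-independent P-ind Q-ind apart u u' u∈ u'∈ with ∈mix⁻ u∈ | ∈mix⁻ u'∈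
    ... | inj₁ (_ , u∈P)  | inj₁ (_ , u'∈P)   = P-ind u u' u∈P u'∈P
    ... | inj₂ (_ , u∈Q)  | inj₂ (_ , u'∈Q)   = Q-ind u u' u∈Q u'∈Q
    ... | inj₁ (zu , u∈P) | inj₂ (¬zu' , u'∈Q) = apart u u' u∈P zu u'∈Q ¬zu'
    ... | inj₂ (¬zu , u∈Q) | inj₁ (zu' , u'∈P) = apart u' u u'∈P zu' u∈Q ¬zu ∘ adj-sym

  private variable
    ℓ : ℕ

  data Walk : Subset n → Subset n → ℕ → Set where
    nil  : Independent G S → Walk S S 0
    cons : Independent G S → Move G S T x y → Walk T U ℓ → Walk S U (suc ℓ)

  snoc : Walk S T ℓ → Move G T U x y → Independent G U → Walk S U (suc ℓ)
  snoc (nil S-ind)       mv U-ind = cons S-ind mv (nil U-ind)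
  snoc (cons S-ind mv w) mv' U-ind = cons S-ind mv (snoc w mv' U-ind)

  private
    sets : Walk S U ℓ → Fin (suc ℓ) → Subset n
    sets {S} (nil _)      _        = S
    sets {S} (cons _ _ _) fzero    = S
    sets (cons _ _ w)     (fsuc i) = sets w i

    sets-first : (w : Walk S U ℓ) → sets w fzero ≡ S
    sets-first (nil _)      = refl
    sets-first (cons _ _ _) = refl

    sets-last : (w : Walk S U ℓ) → sets w (fromℕ ℓ) ≡ U
    sets-last (nil _)      = refl
    sets-last (cons _ _ w) = sets-last w

    sets-independent : (w : Walk S U ℓ) → ∀ i → Independent G (sets w i)
    sets-independent (nil S-ind)      _        = S-ind
    sets-independent (cons S-ind _ _) fzero    = S-ind
    sets-independent (cons _ _ w)     (fsuc i) = sets-independent w i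

    sets-step : (w : Walk S U ℓ) (i : Fin ℓ) → ∃₂ λ a b → Move G (sets w (inject₁ i)) (sets w (fsuc i)) a b
    sets-step (cons {x = x} {y = y} _ mv w) fzero = x , y , subst (λ T → Move G _ T x y) (sym (sets-first w)) mv
    sets-step (cons _ _ w) (fsuc i) = sets-step w i

  Walk⇒TSSeq : Walk S U ℓ → Σ (TSSeq G) λ τ → TSSeq.len τ ≡ ℓ × TSSeq.sets τ fzero ≡ S × TSSeq.final τ ≡ U
  Walk⇒TSSeq {ℓ = ℓ} w =
    record { len = ℓ ; sets = sets w ; indep = sets-independent w ; step = sets-step w } ,
    refl , sets-first w , sets-last w

  skip-idle : (U : ℕ → Subset n) (L : ℕ) →
    (∀ t → t ≤ L → Independent G (U t)) →
    (∀ t → t < L → (∃₂ λ x y → Move G (U t) (U (suc t)) x y) ⊎ U (suc t) ≡ U t) →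
    ∀ {t₀} → t₀ < L → U (suc t₀) ≡ U t₀ →
    Σ ℕ λ ℓ → Walk (U 0) (U L) ℓ × ℓ < L
  skip-idle U L U-ind steps {t₀} t₀<L idle with walk-to L ≤-refl
    where
      walk-to : ∀ t → t ≤ L → Σ ℕ λ ℓ → Walk (U 0) (U t) ℓ × ℓ ≤ t × (t₀ < t → ℓ < t)
      walk-to zero    _   = 0 , nil (U-ind 0 z≤n) , z≤n , λ ()
      walk-to (suc t) t<L with walk-to t (≤-trans (n≤1+n t) t<L) | t ≟ℕ t₀
      ... | ℓ , w , ℓ≤t , _ | yes refl = ℓ , subst (λ T → Walk (U 0) T ℓ) (sym idle) w , m≤n⇒m≤1+n ℓ≤t , λ _ → s≤s ℓ≤t
      ... | ℓ , w , ℓ≤t , shorter | no t≢t₀ with steps t t<L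
      ...   | inj₁ (x , y , mv) = suc ℓ , snoc w mv (U-ind (suc t) t<L) , s≤s ℓ≤t ,
                                  λ t₀<1+t → s≤s (shorter (≤∧≢⇒< (≤-pred t₀<1+t) (t≢t₀ ∘ sym)))
      ...   | inj₂ same         = ℓ , subst (λ T → Walk (U 0) T ℓ) (sym same) w , m≤n⇒m≤1+n ℓ≤t , λ _ → s≤s ℓ≤t
  ... | ℓ , w , _ , shorter = ℓ , w , shorter t₀<L

module _ (G : Graph) (claw-free : ClawFree G) {I : Subset (Graph.n G)}
         (I-independent : Independent G I) (C : BadCycle G I) where
  open Graph G renaming (sym to adj-sym)
  open BadCycle C renaming (len to k; len≥3 to 3≤k; inj to v-injective; induced to v-induced; alt to v-alternates)
  open CyclicOrder G
  open Moves G

  private variable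
    x y b b' : Fin n

  ∈B⁻ : x ∈ B → x ∉ I × ∃ λ i → v i ≡ x
  ∈B⁻ = ∈-toSubset⁻ (λ w → ¬? (w ∈? I) ×-dec any? (λ i → v i ≟ᶠ w))

  ∉I⇒∈B : ∀ {i} → v i ∉ I → v i ∈ B
  ∉I⇒∈B {i} v∉I = ∈-toSubset⁺ (λ w → ¬? (w ∈? I) ×-dec any? (λ i → v i ≟ᶠ w)) (v∉I , i , refl)

  v-adj⇒Succ : ∀ {i j} → Adj (v i) (v j) → Succ G i j ⊎ Succ G j i
  v-adj⇒Succ = Equivalence.to (v-induced _ _)

  v-adj-next : ∀ i → Adj (v i) (v (next i))
  v-adj-next i = Equivalence.from (v-induced _ _) (inj₁ (Succ-next i))

  v-adj-prev : ∀ i → Adj (v i) (v (prev i))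
  v-adj-prev i = Equivalence.from (v-induced _ _) (inj₂ (Succ-prev i))

  v-next≢v-prev : ∀ i → v (next i) ≢ v (prev i)
  v-next≢v-prev i = next≢prev 3≤k i ∘ v-injective

  ∈I⇒next∉I : ∀ {i} → v i ∈ I → v (next i) ∉ I
  ∈I⇒next∉I {i} v∈I with v-alternates i (next i) (Succ-next i)
  ... | inj₁ (_ , next∉I) = next∉I
  ... | inj₂ (v∉I , _)    = contradiction v∈I v∉I

  ∉I⇒next∈I : ∀ {i} → v i ∉ I → v (next i) ∈ I
  ∉I⇒next∈I {i} v∉I with v-alternates i (next i) (Succ-next i)
  ... | inj₁ (v∈I , _)    = contradiction v∈I v∉I
  ... | inj₂ (_ , next∈I) = next∈I

  ∈I⇒prev∉I : ∀ {i} → v i ∈ I → v (prev i) ∉ I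
  ∈I⇒prev∉I {i} v∈I with v-alternates (prev i) i (Succ-prev i)
  ... | inj₁ (_ , v∉I)    = contradiction v∈I v∉I
  ... | inj₂ (prev∉I , _) = prev∉I

  ∉I⇒prev∈I : ∀ {i} → v i ∉ I → v (prev i) ∈ I
  ∉I⇒prev∈I {i} v∉I with v-alternates (prev i) i (Succ-prev i)
  ... | inj₁ (prev∈I , _) = prev∈I
  ... | inj₂ (_ , v∈I)    = contradiction v∈I v∉I

  ∈I⇒next∈B : ∀ {i} → v i ∈ I → v (next i) ∈ B
  ∈I⇒next∈B = ∉I⇒∈B ∘ ∈I⇒next∉I

  ∈I⇒prev∈B : ∀ {i} → v i ∈ I → v (prev i) ∈ B
  ∈I⇒prev∈B = ∉I⇒∈B ∘ ∈I⇒prev∉I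

  B-independent : Independent G B
  B-independent _ _ x∈B y∈B xy with ∈B⁻ x∈B | ∈B⁻ y∈B
  ... | x∉I , i , refl | y∉I , j , refl with v-adj⇒Succ xy
  ...   | inj₁ i→j = [ x∉I ∘ proj₁ , y∉I ∘ proj₂ ]′ (v-alternates i j i→j)
  ...   | inj₂ j→i = [ y∉I ∘ proj₁ , x∉I ∘ proj₂ ]′ (v-alternates j i j→i)

  AdjB : Fin n → Set
  AdjB x = ∃ λ b → b ∈ B × Adj x b

  AdjB? : ∀ x → Dec (AdjB x)
  AdjB? x = any? (λ b → (b ∈? B) ×-dec adj? x b)

  N₀⇒¬AdjB : InN G 0 B x → ¬ AdjB x
  N₀⇒¬AdjB {x} (_ , ∣N∩B∣≡0) (b , b∈B , xb) =
    <-irrefl refl (subst (0 <_) ∣N∩B∣≡0 (x∈p⇒0<∣p∣ (x∈p∩q⁺ (∈-toSubset⁺ (adj? x) xb , b∈B))))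

  N₂⇒AdjB : InN G 2 B x → AdjB x
  N₂⇒AdjB {x} (_ , ∣N∩B∣≡2) with ∣p∣≢0⇒Nonempty (λ ∣N∩B∣≡0 → case (trans (sym ∣N∩B∣≡2) ∣N∩B∣≡0))
    where case : 2 ≢ 0
          case ()
  ... | b , b∈N∩B with x∈p∩q⁻ (Nbhd G x) B b∈N∩B
  ...   | b∈N , b∈B = b , b∈B , ∈-toSubset⁻ (adj? x) b∈N

  ¬AdjB⇒N₀ : x ∉ B → ¬ AdjB x → InN G 0 B x
  ¬AdjB⇒N₀ {x} x∉B ¬adjB = x∉B , Empty⇒∣p∣≡0 λ { (b , b∈N∩B) →
    let b∈N , b∈B = x∈p∩q⁻ (Nbhd G x) B b∈N∩B in ¬adjB (b , b∈B , ∈-toSubset⁻ (adj? x) b∈N) }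

  exactly-two-B-neighbours⇒N₂ : x ∉ B → b ≢ b' → b ∈ B → b' ∈ B → Adj x b → Adj x b' →
                                (∀ {c} → c ∈ B → Adj x c → c ≡ b ⊎ c ≡ b') → InN G 2 B x
  exactly-two-B-neighbours⇒N₂ {x} x∉B b≢b' b∈B b'∈B xb xb' only =
    x∉B , ∣p∣≡2 b≢b' (x∈p∩q⁺ (∈-toSubset⁺ (adj? x) xb , b∈B)) (x∈p∩q⁺ (∈-toSubset⁺ (adj? x) xb' , b'∈B))
      λ c∈N∩B → let c∈N , c∈B = x∈p∩q⁻ (Nbhd G x) B c∈N∩B in only c∈B (∈-toSubset⁻ (adj? x) c∈N)

  -- a claw centred at y
  common-neighbour-B-neighbours : ∀ {i y b} → v i ∈ I → Adj y (v (prev i)) → Adj y (v (next i)) →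
                                  b ∈ B → Adj y b → b ≡ v (prev i) ⊎ b ≡ v (next i)
  common-neighbour-B-neighbours {i} {y} {b} v∈I y-prev y-next b∈B yb with b ≟ᶠ v (prev i) | b ≟ᶠ v (next i)
  ... | yes b≡ | _      = inj₁ b≡
  ... | no _   | yes b≡ = inj₂ b≡
  ... | no b≢prev | no b≢next =
    ⊥-elim (claw-free y (v (prev i)) (v (next i)) b y-prev y-next yb
      (v-next≢v-prev i ∘ sym) (b≢prev ∘ sym) (b≢next ∘ sym)
      (B-independent _ _ prev∈B next∈B) (B-independent _ _ prev∈B b∈B) (B-independent _ _ next∈B b∈B))
    where
      prev∈B : v (prev i) ∈ B
      prev∈B = ∈I⇒prev∈B v∈I
      next∈B : v (next i) ∈ B
      next∈B = ∈I⇒next∈B v∈I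

  -- ρ follows C into S ∪ B: the B-vertices stay put, the token on each A-vertex v c has moved
  -- to ρ c ∈ S, the images still form a cycle, and every other token of S is away from B.
  record Tracks (S : Subset n) (ρ : Fin k → Fin n) : Set where
    field
      independent : Independent G S
      fixes-B     : ∀ c → v c ∉ I → ρ c ≡ v c
      A-into-S    : ∀ c → v c ∈ I → ρ c ∈ S
      adjacent    : ∀ c → Adj (ρ c) (ρ (next c))
      injective   : ∀ c c' → ρ c ≡ ρ c' → c ≡ c'
      covers      : ∀ x → x ∈ S → (∃ λ c → v c ∈ I × x ≡ ρ c) ⊎ ¬ AdjB x

  Tracks⇒cycle : ∀ {S ρ} → Tracks S ρ → HasCycleIn G (S ∪ B)
  Tracks⇒cycle {S} {ρ} t = k , 3≤k , ρ , (λ {c} {c'} → injective c c') , ρ∈ , ρ-adj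
    where
      open Tracks t
      ρ∈ : ∀ c → ρ c ∈ S ∪ B
      ρ∈ c with v c ∈? I
      ... | yes v∈I = x∈p∪q⁺ (inj₁ (A-into-S c v∈I))
      ... | no  v∉I = x∈p∪q⁺ (inj₂ (subst (_∈ B) (sym (fixes-B c v∉I)) (∉I⇒∈B v∉I)))
      ρ-adj : ∀ c c' → Succ G c c' → Adj (ρ c) (ρ c')
      ρ-adj c c' c→c' = subst (λ c'' → Adj (ρ c) (ρ c'')) (sym (Succ⇒≡next c→c')) (adjacent c)

  Tracks-I : Tracks I v
  Tracks-I = record
    { independent = I-independent ; fixes-B = λ _ _ → refl ; A-into-S = λ _ v∈I → v∈I
    ; adjacent = v-adj-next ; injective = λ _ _ → v-injective ; covers = covers }
    where
      covers : ∀ x → x ∈ I → (∃ λ c → v c ∈ I × x ≡ v c) ⊎ ¬ AdjB x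
      covers x x∈I with AdjB? x
      ... | no ¬adjB = inj₂ ¬adjB
      ... | yes (_ , b∈B , xb) with ∈B⁻ b∈B
      ...   | v∉I , i , refl with x ≟ᶠ v (prev i) | x ≟ᶠ v (next i)
      ...     | yes x≡ | _      = inj₁ (prev i , ∉I⇒prev∈I v∉I , x≡)
      ...     | no _   | yes x≡ = inj₁ (next i , ∉I⇒next∈I v∉I , x≡)
      ...     | no x≢prev | no x≢next =
        ⊥-elim (claw-free (v i) (v (prev i)) (v (next i)) x (v-adj-prev i) (v-adj-next i) (adj-sym xb)
          (v-next≢v-prev i ∘ sym) (x≢prev ∘ sym) (x≢next ∘ sym)
          (I-independent _ _ (∉I⇒prev∈I v∉I) (∉I⇒next∈I v∉I))
          (I-independent _ _ (∉I⇒prev∈I v∉I) x∈I) (I-independent _ _ (∉I⇒next∈I v∉I) x∈I))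

  module TracksFacts {S : Subset n} {ρ : Fin k → Fin n} (t : Tracks S ρ) where
    open Tracks t

    adjacent-prev : ∀ c → Adj (ρ c) (ρ (prev c))
    adjacent-prev c = adj-sym (subst (λ c' → Adj (ρ (prev c)) (ρ c')) (next-prev c) (adjacent (prev c)))

    A-adj-prev : ∀ {c} → v c ∈ I → Adj (ρ c) (v (prev c))
    A-adj-prev {c} v∈I = subst (Adj (ρ c)) (fixes-B _ (∈I⇒prev∉I v∈I)) (adjacent-prev c)

    A-adj-next : ∀ {c} → v c ∈ I → Adj (ρ c) (v (next c))
    A-adj-next {c} v∈I = subst (Adj (ρ c)) (fixes-B _ (∈I⇒next∉I v∈I)) (adjacent c)

    A-AdjB : ∀ {c} → v c ∈ I → AdjB (ρ c)
    A-AdjB v∈I = _ , ∈I⇒next∈B v∈I , A-adj-next v∈I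

    ∈S⇒∉B : x ∈ S → x ∉ B
    ∈S⇒∉B x∈S x∈B with ∈B⁻ x∈B
    ... | v∉I , i , refl =
      independent _ _ x∈S (A-into-S _ (∉I⇒next∈I v∉I)) (subst (λ z → Adj z (ρ (next i))) (fixes-B i v∉I) (adjacent i))

    B-adj-prev : ∀ {c} → v c ∉ I → Adj (v c) (ρ (prev c))
    B-adj-prev {c} v∉I = subst (λ z → Adj z (ρ (prev c))) (fixes-B c v∉I) (adjacent-prev c)

    B-adj-next : ∀ {c} → v c ∉ I → Adj (v c) (ρ (next c))
    B-adj-next {c} v∉I = subst (λ z → Adj z (ρ (next c))) (fixes-B c v∉I) (adjacent c)

    claw-at-B : ∀ {i y} → v i ∉ I → Adj (v i) y → y ≢ ρ (prev i) → y ≢ ρ (next i) →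
                ¬ Adj y (ρ (prev i)) → ¬ Adj y (ρ (next i)) → ⊥
    claw-at-B {i} v∉I vy y≢prev y≢next ¬y-prev ¬y-next =
      claw-free (v i) (ρ (prev i)) (ρ (next i)) _ (B-adj-prev v∉I) (B-adj-next v∉I) vy
        (next≢prev 3≤k i ∘ sym ∘ injective _ _) (y≢prev ∘ sym) (y≢next ∘ sym)
        (independent _ _ (A-into-S _ (∉I⇒prev∈I v∉I)) (A-into-S _ (∉I⇒next∈I v∉I)))
        (¬y-prev ∘ adj-sym) (¬y-next ∘ adj-sym)

    ¬AdjB⇒¬adj-A : ¬ AdjB x → x ∉ B → ∀ {c} → v c ∈ I → ¬ Adj x (ρ c)
    ¬AdjB⇒¬adj-A {x} ¬adjB x∉B {c} v∈I xρ =
      claw-free (ρ c) (v (prev c)) (v (next c)) x (A-adj-prev v∈I) (A-adj-next v∈I) (adj-sym xρ)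
        (v-next≢v-prev c ∘ sym) (x∉B ∘ λ eq → subst (_∈ B) eq prev∈B) (x∉B ∘ λ eq → subst (_∈ B) eq next∈B)
        (B-independent _ _ prev∈B next∈B)
        (λ b⁻x → ¬adjB (_ , prev∈B , adj-sym b⁻x)) (λ b⁺x → ¬adjB (_ , next∈B , adj-sym b⁺x))
      where
        prev∈B : v (prev c) ∈ B
        prev∈B = ∈I⇒prev∈B v∈I
        next∈B : v (next c) ∈ B
        next∈B = ∈I⇒next∈B v∈I

    adjacent-images : ∀ c c' → Adj (ρ c) (ρ c') → c' ≡ next c ⊎ c' ≡ prev c
    adjacent-images c c' ρρ' with v c ∈? I | v c' ∈? I
    ... | yes c∈ | yes c'∈ = ⊥-elim (independent _ _ (A-into-S c c∈) (A-into-S c' c'∈) ρρ')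
    ... | no c∉  | no c'∉  =
      ⊥-elim (B-independent _ _ (∉I⇒∈B c∉) (∉I⇒∈B c'∉) (subst₂ Adj (fixes-B c c∉) (fixes-B c' c'∉) ρρ'))
    ... | yes c∈ | no c'∉ with common-neighbour-B-neighbours c∈ (A-adj-prev c∈) (A-adj-next c∈) (∉I⇒∈B c'∉)
                                 (subst (Adj (ρ c)) (fixes-B c' c'∉) ρρ')
    ...   | inj₁ eq = inj₂ (v-injective eq)
    ...   | inj₂ eq = inj₁ (v-injective eq)
    adjacent-images c c' ρρ' | no c∉ | yes c'∈
      with common-neighbour-B-neighbours c'∈ (A-adj-prev c'∈) (A-adj-next c'∈) (∉I⇒∈B c∉)
             (subst (Adj (ρ c')) (fixes-B c c∉) (adj-sym ρρ'))
    ... | inj₁ eq = inj₁ (trans (sym (next-prev c')) (cong next (sym (v-injective eq))))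
    ... | inj₂ eq = inj₂ (trans (sym (prev-next c')) (cong prev (sym (v-injective eq))))

  ¬AdjB-apart-from-AdjB : ∀ {S ρ S' ρ'} → Tracks S ρ → Tracks S' ρ' →
                          ∀ {a a'} → a ∈ S → ¬ AdjB a → a' ∈ S' → AdjB a' → ¬ Adj a a'
  ¬AdjB-apart-from-AdjB t t' {a} {a'} a∈S ¬adjB a'∈S' adjB with Tracks.covers t' a' a'∈S'
  ... | inj₂ ¬adjB' = ⊥-elim (¬adjB' adjB)
  ... | inj₁ (c , v∈I , refl) = TracksFacts.¬AdjB⇒¬adj-A t' ¬adjB (TracksFacts.∈S⇒∉B t a∈S) v∈I

  Tracks-transfer : ∀ {S U ρ} → Tracks S ρ → Independent G U →
                    (∀ {q} → AdjB q → q ∈ U → q ∈ S) → (∀ {q} → AdjB q → q ∈ S → q ∈ U) → Tracks U ρ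
  Tracks-transfer {S} {U} {ρ} t U-ind U⊆S S⊆U = record
    { independent = U-ind ; fixes-B = fixes-B ; A-into-S = λ c v∈I → S⊆U (A-AdjB v∈I) (A-into-S c v∈I)
    ; adjacent = adjacent ; injective = injective ; covers = covers' }
    where
      open Tracks t
      open TracksFacts t
      covers' : ∀ q → q ∈ U → (∃ λ c → v c ∈ I × q ≡ ρ c) ⊎ ¬ AdjB q
      covers' q q∈U with AdjB? q
      ... | yes adjB = covers q (U⊆S adjB q∈U)
      ... | no ¬adjB = inj₂ ¬adjB

  module Step {S S' : Subset n} {ρ : Fin k → Fin n} {x y : Fin n}
              (t : Tracks S ρ) (S'-independent : Independent G S') (mv : Move G S S' x y) where
    open Tracks t
    open TracksFacts t

    private
      y∈S' : y ∈ S'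
      y∈S' = proj₁ (Move-target mv)

      stays : ∀ {c} → v c ∈ I → ρ c ≢ x → ρ c ∈ S'
      stays v∈I ρ≢x = Move-keeps mv (A-into-S _ v∈I) ρ≢x

      y≢A-image : ∀ {c} → v c ∈ I → y ≢ ρ c
      y≢A-image v∈I eq = proj₂ (Move-target mv) (subst (_∈ S) (sym eq) (A-into-S _ v∈I))

    ¬adj-B-between-stayers : ∀ {i} → v i ∉ I → ρ (prev i) ≢ x → ρ (next i) ≢ x → ¬ Adj y (v i)
    ¬adj-B-between-stayers {i} v∉I prev-stays next-stays yv =
      claw-at-B v∉I (adj-sym yv) (y≢A-image prev∈I) (y≢A-image next∈I)
        (S'-independent _ _ y∈S' (stays prev∈I prev-stays)) (S'-independent _ _ y∈S' (stays next∈I next-stays))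
      where
        prev∈I : v (prev i) ∈ I
        prev∈I = ∉I⇒prev∈I v∉I
        next∈I : v (next i) ∈ I
        next∈I = ∉I⇒next∈I v∉I

    y∉B : y ∉ B
    y∉B y∈B with ∈B⁻ y∈B
    ... | v∉I , i , refl with ρ (prev i) ≟ᶠ x | ρ (next i) ≟ᶠ x
    ...   | no prev-stays | _ = S'-independent _ _ y∈S' (stays (∉I⇒prev∈I v∉I) prev-stays) (B-adj-prev v∉I)
    ...   | yes _ | no next-stays = S'-independent _ _ y∈S' (stays (∉I⇒next∈I v∉I) next-stays) (B-adj-next v∉I)
    ...   | yes prev≡x | yes next≡x = next≢prev 3≤k i (injective _ _ (trans next≡x (sym prev≡x)))

    external-move : ¬ AdjB x → ¬ AdjB y × Tracks S' ρ
    external-move ¬adjB = ¬adjB-y , record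
      { independent = S'-independent ; fixes-B = fixes-B ; A-into-S = λ c v∈I → stays v∈I (A-image≢x v∈I)
      ; adjacent = adjacent ; injective = injective ; covers = covers' }
      where
        A-image≢x : ∀ {c} → v c ∈ I → ρ c ≢ x
        A-image≢x v∈I eq = ¬adjB (subst AdjB eq (A-AdjB v∈I))
        ¬adjB-y : ¬ AdjB y
        ¬adjB-y (b , b∈B , yb) with ∈B⁻ b∈B
        ... | v∉I , i , refl =
          ¬adj-B-between-stayers v∉I (A-image≢x (∉I⇒prev∈I v∉I)) (A-image≢x (∉I⇒next∈I v∉I)) yb
        covers' : ∀ z → z ∈ S' → (∃ λ c → v c ∈ I × z ≡ ρ c) ⊎ ¬ AdjB z
        covers' z z∈S' with z ≟ᶠ y
        ... | yes refl = inj₂ ¬adjB-y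
        ... | no z≢y   = covers z (Move-back mv z∈S' z≢y)

    y≢image : ∀ c → y ≢ ρ c
    y≢image c eq with v c ∈? I
    ... | yes v∈I = y≢A-image v∈I eq
    ... | no  v∉I = y∉B (subst (_∈ B) (sym (trans eq (fixes-B c v∉I))) (∉I⇒∈B v∉I))

    module FromImage {r : Fin k} (r∈A : v r ∈ I) (x≡ρr : x ≡ ρ r) where

      b⁻ b⁺ : Fin n
      b⁻ = v (prev r)
      b⁺ = v (next r)

      private
        b⁻∈B : b⁻ ∈ B
        b⁻∈B = ∈I⇒prev∈B r∈A

        b⁺∈B : b⁺ ∈ B
        b⁺∈B = ∈I⇒next∈B r∈A

        b⁻≢b⁺ : b⁻ ≢ b⁺
        b⁻≢b⁺ = v-next≢v-prev r ∘ sym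

        x-b⁻ : Adj x b⁻
        x-b⁻ = subst (λ z → Adj z b⁻) (sym x≡ρr) (A-adj-prev r∈A)

        x-b⁺ : Adj x b⁺
        x-b⁺ = subst (λ z → Adj z b⁺) (sym x≡ρr) (A-adj-next r∈A)

        others-stay : ∀ {c} → c ≢ r → ρ c ≢ x
        others-stay c≢r eq = c≢r (injective _ _ (trans eq x≡ρr))

      y-B-neighbours : b ∈ B → Adj y b → b ≡ b⁻ ⊎ b ≡ b⁺
      y-B-neighbours b∈B yb with ∈B⁻ b∈B
      ... | v∉I , i , refl with i ≟ᶠ prev r | i ≟ᶠ next r
      ...   | yes i≡ | _      = inj₁ (cong v i≡)
      ...   | no _   | yes i≡ = inj₂ (cong v i≡)
      ...   | no i≢prev | no i≢next = ⊥-elim (¬adj-B-between-stayers v∉I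
              (others-stay λ eq → i≢next (trans (sym (next-prev i)) (cong next eq)))
              (others-stay λ eq → i≢prev (trans (sym (prev-next i)) (cong prev eq))) yb)

      x∈N₂ : InN G 2 B x
      x∈N₂ = exactly-two-B-neighbours⇒N₂ (∈S⇒∉B (proj₁ (Move-source mv))) b⁻≢b⁺ b⁻∈B b⁺∈B x-b⁻ x-b⁺
               (common-neighbour-B-neighbours r∈A x-b⁻ x-b⁺)

      -- a claw centred at x otherwise
      y-AdjB : AdjB y
      y-AdjB with AdjB? y
      ... | yes adjB = adjB
      ... | no ¬adjB = ⊥-elim (claw-free x b⁻ b⁺ y x-b⁻ x-b⁺ (Move-adj mv) b⁻≢b⁺
              (y∉B ∘ λ eq → subst (_∈ B) eq b⁻∈B) (y∉B ∘ λ eq → subst (_∈ B) eq b⁺∈B) (B-independent _ _ b⁻∈B b⁺∈B)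
              (λ b⁻y → ¬adjB (_ , b⁻∈B , adj-sym b⁻y)) (λ b⁺y → ¬adjB (_ , b⁺∈B , adj-sym b⁺y)))

      module Internal (y-b⁻ : Adj y b⁻) (y-b⁺ : Adj y b⁺) where

        y∈N₂ : InN G 2 B y
        y∈N₂ = exactly-two-B-neighbours⇒N₂ y∉B b⁻≢b⁺ b⁻∈B b⁺∈B y-b⁻ y-b⁺
                 (common-neighbour-B-neighbours r∈A y-b⁻ y-b⁺)

        ρ' : Fin k → Fin n
        ρ' = updateAt ρ r (λ _ → y)

        private
          ρ'-r : ρ' r ≡ y
          ρ'-r = updateAt-updates r ρ

          ρ'-other : ∀ {c} → c ≢ r → ρ' c ≡ ρ c
          ρ'-other {c} c≢r = updateAt-minimal c r ρ c≢r

          B-position≢r : ∀ {c} → v c ∉ I → c ≢ r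
          B-position≢r v∉I refl = v∉I r∈A

          ρ'-adjacent : ∀ c → Adj (ρ' c) (ρ' (next c))
          ρ'-adjacent c with c ≟ᶠ r
          ... | yes refl = subst₂ Adj (sym ρ'-r) (sym (trans (ρ'-other (next≢id 3≤k r)) (fixes-B _ (∈I⇒next∉I r∈A)))) y-b⁺
          ... | no c≢r with next c ≟ᶠ r
          ...   | no next≢r = subst₂ Adj (sym (ρ'-other c≢r)) (sym (ρ'-other next≢r)) (adjacent c)
          ...   | yes next≡r = subst₂ Adj (sym (trans (ρ'-other c≢r) (fixes-B c c∉I))) (sym (trans (cong ρ' next≡r) ρ'-r))
                                 (subst (λ c' → Adj (v c') y) (sym c≡prev) (adj-sym y-b⁻))
            where c≡prev : c ≡ prev r
                  c≡prev = trans (sym (prev-next c)) (cong prev next≡r)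
                  c∉I : v c ∉ I
                  c∉I = subst (λ c' → v c' ∉ I) (sym c≡prev) (∈I⇒prev∉I r∈A)

          ρ'-injective : ∀ c c' → ρ' c ≡ ρ' c' → c ≡ c'
          ρ'-injective c c' eq with c ≟ᶠ r | c' ≟ᶠ r
          ... | yes c≡r | yes c'≡r = trans c≡r (sym c'≡r)
          ... | yes refl | no c'≢r = ⊥-elim (y≢image c' (trans (sym ρ'-r) (trans eq (ρ'-other c'≢r))))
          ... | no c≢r | yes refl = ⊥-elim (y≢image c (trans (sym ρ'-r) (trans (sym eq) (ρ'-other c≢r))))
          ... | no c≢r | no c'≢r = injective c c' (trans (sym (ρ'-other c≢r)) (trans eq (ρ'-other c'≢r)))

          ρ'-covers : ∀ z → z ∈ S' → (∃ λ c → v c ∈ I × z ≡ ρ' c) ⊎ ¬ AdjB z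
          ρ'-covers z z∈S' with z ≟ᶠ y
          ... | yes z≡y = inj₁ (r , r∈A , trans z≡y (sym ρ'-r))
          ... | no z≢y with covers z (Move-back mv z∈S' z≢y)
          ...   | inj₂ ¬adjB = inj₂ ¬adjB
          ...   | inj₁ (c , v∈I , z≡ρc) = inj₁ (c , v∈I , trans z≡ρc (sym (ρ'-other c≢r)))
            where c≢r : c ≢ r
                  c≢r refl = proj₂ (Move-source mv) (subst (_∈ S') (trans z≡ρc (sym x≡ρr)) z∈S')

        Tracks-after : Tracks S' ρ'
        Tracks-after = record
          { independent = S'-independent
          ; fixes-B = λ c v∉I → trans (ρ'-other (B-position≢r v∉I)) (fixes-B c v∉I)
          ; A-into-S = A-into-S'
          ; adjacent = ρ'-adjacent ; injective = ρ'-injective ; covers = ρ'-covers }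
          where
            A-into-S' : ∀ c → v c ∈ I → ρ' c ∈ S'
            A-into-S' c v∈I with c ≟ᶠ r
            ... | yes refl = subst (_∈ S') (sym ρ'-r) y∈S'
            ... | no c≢r   = subst (_∈ S') (sym (ρ'-other c≢r)) (stays v∈I (others-stay c≢r))

      module Resolving (not-both : ¬ (Adj y b⁻ × Adj y b⁺)) where

        two-B-neighbours-impossible : b ∈ B → b' ∈ B → b ≢ b' → Adj y b → Adj y b' → ⊥
        two-B-neighbours-impossible b∈B b'∈B b≢b' yb yb' with y-B-neighbours b∈B yb | y-B-neighbours b'∈B yb'
        ... | inj₁ refl | inj₁ refl = b≢b' refl
        ... | inj₂ refl | inj₂ refl = b≢b' refl
        ... | inj₁ refl | inj₂ refl = not-both (yb , yb')
        ... | inj₂ refl | inj₁ refl = not-both (yb' , yb)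

        module CycleAfter {k'} {w : Fin k' → Fin n} (3≤k' : 3 ≤ k') (w-injective : ∀ {i i'} → w i ≡ w i' → i ≡ i')
                          (w∈ : ∀ i → w i ∈ S' ∪ B) (w-adj : ∀ i i' → Succ G i i' → Adj (w i) (w i')) where

          private
            w-next : ∀ i → Adj (w i) (w (next i))
            w-next i = w-adj _ _ (Succ-next i)

            w-prev : ∀ i → Adj (w i) (w (prev i))
            w-prev i = adj-sym (w-adj _ _ (Succ-prev i))

            w-next≢w-prev : ∀ i → w (next i) ≢ w (prev i)
            w-next≢w-prev i = next≢prev 3≤k' i ∘ w-injective

            neighbour-in-B : ∀ {i i'} → w i ∈ S' → Adj (w i) (w i') → w i' ∈ B
            neighbour-in-B {i} {i'} w∈S' ww' with x∈p∪q⁻ S' B (w∈ i')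
            ... | inj₁ w'∈S' = ⊥-elim (S'-independent _ _ w∈S' w'∈S' ww')
            ... | inj₂ w'∈B  = w'∈B

          on-image : ∀ i → ∃ λ c → w i ≡ ρ c
          on-image i with x∈p∪q⁻ S' B (w∈ i)
          ... | inj₂ w∈B with ∈B⁻ w∈B
          ...   | w∉I , c , v≡w = c , sym (trans (fixes-B c (subst (λ z → z ∉ I) (sym v≡w) w∉I)) v≡w)
          on-image i | inj₁ w∈S' with w i ≟ᶠ y
          ...   | yes refl = ⊥-elim (two-B-neighbours-impossible (neighbour-in-B w∈S' (w-next i))
                               (neighbour-in-B w∈S' (w-prev i)) (w-next≢w-prev i) (w-next i) (w-prev i))
          ...   | no w≢y with covers (w i) (Move-back mv w∈S' w≢y)
          ...     | inj₁ (c , _ , w≡ρc) = c , w≡ρc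
          ...     | inj₂ ¬adjB = ⊥-elim (¬adjB (_ , neighbour-in-B w∈S' (w-next i) , w-next i))

          Met : Fin k → Set
          Met c = ∃ λ i → w i ≡ ρ c

          met-next : ∀ c → Met c → Met (next c)
          met-next c (i , w≡ρc) with on-image (next i) | on-image (prev i)
          ... | c₁ , w≡ρc₁ | c₂ , w≡ρc₂ with adjacent-images c c₁ (subst₂ Adj w≡ρc w≡ρc₁ (w-next i))
          ...   | inj₁ c₁≡next = next i , trans w≡ρc₁ (cong ρ c₁≡next)
          ...   | inj₂ c₁≡prev with adjacent-images c c₂ (subst₂ Adj w≡ρc w≡ρc₂ (w-prev i))
          ...     | inj₁ c₂≡next = prev i , trans w≡ρc₂ (cong ρ c₂≡next)
          ...     | inj₂ c₂≡prev = ⊥-elim (w-next≢w-prev i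
                      (trans w≡ρc₁ (trans (cong ρ (trans c₁≡prev (sym c₂≡prev))) (sym w≡ρc₂))))

          x-not-met : ¬ Met r
          x-not-met (i , w≡ρr) with x∈p∪q⁻ S' B (w∈ i)
          ... | inj₁ w∈S' = proj₂ (Move-source mv) (subst (_∈ S') (trans w≡ρr (sym x≡ρr)) w∈S')
          ... | inj₂ w∈B  = ∈S⇒∉B (proj₁ (Move-source mv)) (subst (_∈ B) (trans w≡ρr (sym x≡ρr)) w∈B)

        -- The images met by a cycle in S' ∪ B are closed under next, so the cycle would meet x = ρ r.
        no-cycle-after : ¬ HasCycleIn G (S' ∪ B)
        no-cycle-after (zero , () , _)
        no-cycle-after (suc _ , 3≤k' , w , w-injective , w∈ , w-adj) =
          x-not-met (cyclic-induction Met met-next (fzero , proj₂ (on-image fzero)) r)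
          where open CycleAfter 3≤k' w-injective w∈ w-adj

  module ShortestResolution (σ : TSSeq G) (shortest : Shortest G C σ) where
    open TSSeq σ renaming (len to m)

    resolves : Resolves G C σ
    resolves = proj₁ shortest

    -- the sets of σ indexed by ℕ, with F t the final set for every t ≥ m
    F : ℕ → Subset n
    F t = sets (fromℕ< (s≤s (m⊓n≤n t m)))

    F-toℕ : (i : Fin (suc m)) → F (toℕ i) ≡ sets i
    F-toℕ i = cong sets (toℕ-injective (trans (toℕ-fromℕ< _) (m≤n⇒m⊓n≡m (≤-pred (toℕ<n i)))))

    F-inject₁ : (i : Fin m) → F (toℕ i) ≡ sets (inject₁ i)
    F-inject₁ i = trans (cong F (sym (toℕ-inject₁ i))) (F-toℕ (inject₁ i))

    F-0 : F 0 ≡ I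
    F-0 = trans (F-toℕ fzero) (proj₁ resolves)

    F-m : F m ≡ final
    F-m = trans (cong F (sym (toℕ-fromℕ m))) (F-toℕ (fromℕ m))

    F-independent : ∀ t → Independent G (F t)
    F-independent t = indep _

    move-at : ∀ {t} → t < m → ∃₂ λ x y → Move G (F t) (F (suc t)) x y
    move-at {t} t<m = subst (λ t' → ∃₂ λ x y → Move G (F t') (F (suc t')) x y) (toℕ-fromℕ< t<m)
      (subst₂ (λ S S' → ∃₂ λ x y → Move G S S' x y) (sym (F-inject₁ index)) (sym (F-toℕ (fsuc index))) (step index))
      where index : Fin m
            index = fromℕ< t<m

    prefix : ∀ t → t ≤ m → Walk (F 0) (F t) t
    prefix zero    _     = nil (F-independent 0)
    prefix (suc t) 1+t≤m = let _ , _ , mv = move-at 1+t≤m in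
      snoc (prefix t (≤-trans (n≤1+n t) 1+t≤m)) mv (F-independent (suc t))

    resolving-walk-length : ∀ {U ℓ} → Walk (F 0) U ℓ → ¬ HasCycleIn G (U ∪ B) → m ≤ ℓ
    resolving-walk-length w no-cycle with Walk⇒TSSeq w
    ... | τ , refl , τ-first , τ-final =
      proj₂ shortest τ (trans τ-first F-0 , subst (λ U → ¬ HasCycleIn G (U ∪ B)) (sym τ-final) no-cycle)

    prefix-does-not-resolve : ∀ {t} → t < m → ¬ ¬ HasCycleIn G (F t ∪ B)
    prefix-does-not-resolve t<m no-cycle = <⇒≱ t<m (resolving-walk-length (prefix _ (<⇒≤ t<m)) no-cycle)

    MoveWithin : (Fin n → Set) → ℕ → Set
    MoveWithin Z t = ∃₂ λ x y → Move G (F t) (F (suc t)) x y × Z x × Z y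

    MoveWithin-map : ∀ {Z Z' t} → (∀ {x} → Z x → Z' x) → MoveWithin Z t → MoveWithin Z' t
    MoveWithin-map f (x , y , mv , zx , zy) = x , y , mv , f zx , f zy

    at-index : ∀ {Z} (i : Fin m) → MoveWithin Z (toℕ i) →
               ∃₂ λ u w → Move G (sets (inject₁ i)) (sets (fsuc i)) u w × Z u × Z w
    at-index i (u , w , mv , zu , zw) = u , w , subst₂ (λ S S' → Move G S S' u w) (F-inject₁ i) (F-toℕ (fsuc i)) mv , zu , zw

    Tracked : ℕ → Set
    Tracked t = ∃ λ ρ → Tracks (F t) ρ

    Outcome : ℕ → Set
    Outcome t = Tracked (suc t) × (MoveWithin (InN G 0 B) t ⊎ MoveWithin (InN G 2 B) t)

    -- σ is shortest, so a non-final move does not resolve C: it is external or internal, and C stays tracked.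
    non-final-move : ∀ {t} → suc t < m → Tracked t → Outcome t
    non-final-move {t} 1+t<m (ρ , tracks) with move-at (<-trans (n<1+n t) 1+t<m)
    ... | x , y , mv = by-source (Tracks.covers tracks x x∈S)
      where
        open Step tracks (F-independent (suc t)) mv
        x∈S : x ∈ F t
        x∈S = proj₁ (Move-source mv)
        by-source : (∃ λ c → v c ∈ I × x ≡ ρ c) ⊎ ¬ AdjB x → Outcome t
        by-source (inj₂ ¬adjB-x) =
          (ρ , proj₂ (external-move ¬adjB-x)) ,
          inj₁ (x , y , mv , ¬AdjB⇒N₀ (TracksFacts.∈S⇒∉B tracks x∈S) ¬adjB-x
                           , ¬AdjB⇒N₀ y∉B (proj₁ (external-move ¬adjB-x)))
        by-source (inj₁ (r , r∈A , x≡ρr)) = by-target (adj? y b⁻) (adj? y b⁺)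
          where
            open FromImage r∈A x≡ρr
            by-target : Dec (Adj y b⁻) → Dec (Adj y b⁺) → Outcome t
            by-target (yes y-b⁻) (yes y-b⁺) = (ρ' , Tracks-after) , inj₂ (x , y , mv , x∈N₂ , y∈N₂)
              where open Internal y-b⁻ y-b⁺
            by-target (no ¬y-b⁻) _ = ⊥-elim (prefix-does-not-resolve 1+t<m (Resolving.no-cycle-after (¬y-b⁻ ∘ proj₁)))
            by-target (yes _) (no ¬y-b⁺) = ⊥-elim (prefix-does-not-resolve 1+t<m (Resolving.no-cycle-after (¬y-b⁺ ∘ proj₂)))

    tracked : ∀ t → t < m → Tracked t
    tracked zero    _     = v , subst (λ S → Tracks S v) (sym F-0) Tracks-I
    tracked (suc t) 1+t<m = proj₁ (non-final-move 1+t<m (tracked t (<-trans (n<1+n t) 1+t<m)))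

    non-final-kind : ∀ t → suc t < m → MoveWithin (InN G 0 B) t ⊎ MoveWithin (InN G 2 B) t
    non-final-kind t 1+t<m = proj₂ (non-final-move 1+t<m (tracked t (<-trans (n<1+n t) 1+t<m)))

    resolve-sooner : ∀ {U ρ ℓ r y} → Walk (F 0) U ℓ → suc ℓ < m → Tracks U ρ → v r ∈ I →
                     Adj (ρ r) y → y ∉ U → (∀ q → q ∈ U → q ≢ ρ r → ¬ Adj y q) →
                     ¬ (Adj y (v (prev r)) × Adj y (v (next r))) → ⊥
    resolve-sooner {U} {ρ} {r = r} {y} w 1+ℓ<m tracks r∈A ρr-y y∉U y-free not-both =
      <⇒≱ 1+ℓ<m (resolving-walk-length (snoc w mv U'-independent) no-cycle)
      where
        U' : Subset n
        U' = swap U (ρ r) y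
        mv : Move G U U' (ρ r) y
        mv = swap-move ρr-y (Tracks.A-into-S tracks r r∈A) y∉U
        U'-independent : Independent G U'
        U'-independent = swap-independent (Tracks.independent tracks) y-free
        no-cycle : ¬ HasCycleIn G (U' ∪ B)
        no-cycle = Step.FromImage.Resolving.no-cycle-after tracks U'-independent mv r∈A refl not-both

    module Skipping (Z : Fin n → Set) (Z? : ∀ x → Dec (Z x)) where
      open Mix Z Z?

      skip-non-Z-moves : ∀ {L t₀} →
        (∀ t → t < L → MoveWithin Z t ⊎ MoveWithin (¬_ ∘ Z) t) →
        (∀ t → t ≤ L → ∀ a b → a ∈ F t → Z a → b ∈ F 0 → ¬ Z b → ¬ Adj a b) →
        t₀ < L → MoveWithin (¬_ ∘ Z) t₀ →
        Σ ℕ λ ℓ → Walk (F 0) (mix (F L) (F 0)) ℓ × ℓ < L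
      skip-non-Z-moves {L} kinds apart t₀<L (_ , _ , mv₀ , ¬zx , ¬zy) with
        skip-idle U L U-independent steps t₀<L (mix-idle ¬zx ¬zy mv₀)
        where
          U : ℕ → Subset n
          U t = mix (F t) (F 0)
          U-independent : ∀ t → t ≤ L → Independent G (U t)
          U-independent t t≤L = mix-independent (F-independent t) (F-independent 0) (apart t t≤L)
          steps : ∀ t → t < L → (∃₂ λ x y → Move G (U t) (U (suc t)) x y) ⊎ U (suc t) ≡ U t
          steps t t<L with kinds t t<L
          ... | inj₁ (x , y , mv , zx , zy)   = inj₁ (x , y , mix-move zx zy mv)
          ... | inj₂ (_ , _ , mv , ¬zx , ¬zy) = inj₂ (mix-idle ¬zx ¬zy mv)
      ... | ℓ , w , ℓ<L = ℓ , subst (λ S → Walk S (mix (F L) (F 0)) ℓ) mix-self w , ℓ<L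

    module LastMove (m' : ℕ) (m≡1+m' : m ≡ suc m') where

      private
        ≤m'⇒<m : ∀ {t} → t ≤ m' → t < m
        ≤m'⇒<m t≤m' = subst (_ <_) (sym m≡1+m') (s≤s t≤m')

        <m⇒<m' : ∀ {t} → suc t < m → t < m'
        <m⇒<m' 1+t<m = ≤-pred (subst (_ <_) m≡1+m' 1+t<m)

      ρ : Fin k → Fin n
      ρ = proj₁ (tracked m' (≤m'⇒<m ≤-refl))

      tracks : Tracks (F m') ρ
      tracks = proj₂ (tracked m' (≤m'⇒<m ≤-refl))

      xₗ yₗ : Fin n
      xₗ = proj₁ (move-at (≤m'⇒<m ≤-refl))
      yₗ = proj₁ (proj₂ (move-at (≤m'⇒<m ≤-refl)))

      last : Move G (F m') (F (suc m')) xₗ yₗ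
      last = proj₂ (proj₂ (move-at (≤m'⇒<m ≤-refl)))

      open Step tracks (F-independent (suc m')) last

      resolved : ¬ HasCycleIn G (F (suc m') ∪ B)
      resolved = subst (λ S → ¬ HasCycleIn G (S ∪ B)) (sym (trans (cong F (sym m≡1+m')) F-m)) (proj₂ resolves)

      last-from-image : Σ (Fin k) λ r → Σ (v r ∈ I) λ r∈A → Σ (xₗ ≡ ρ r) λ x≡ρr →
                        ¬ (Adj yₗ (v (prev r)) × Adj yₗ (v (next r)))
      last-from-image with Tracks.covers tracks xₗ (proj₁ (Move-source last))
      ... | inj₂ ¬adjB-x = ⊥-elim (resolved (Tracks⇒cycle (proj₂ (external-move ¬adjB-x))))
      ... | inj₁ (r , r∈A , x≡ρr) =
        r , r∈A , x≡ρr , λ (y-b⁻ , y-b⁺) → resolved (Tracks⇒cycle (FromImage.Internal.Tracks-after r∈A x≡ρr y-b⁻ y-b⁺))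

      r : Fin k
      r = proj₁ last-from-image

      r∈A : v r ∈ I
      r∈A = proj₁ (proj₂ last-from-image)

      x≡ρr : xₗ ≡ ρ r
      x≡ρr = proj₁ (proj₂ (proj₂ last-from-image))

      not-both : ¬ (Adj yₗ (v (prev r)) × Adj yₗ (v (next r)))
      not-both = proj₂ (proj₂ (proj₂ last-from-image))

      open FromImage r∈A x≡ρr
      open Resolving not-both

      yₗ≢A-vertex : ∀ {j} → v j ∈ I → yₗ ≢ v j
      yₗ≢A-vertex {j} v∈I yₗ≡ = two-B-neighbours-impossible (∈I⇒prev∈B v∈I) (∈I⇒next∈B v∈I)
        (v-next≢v-prev j ∘ sym)
        (subst (λ z → Adj z _) (sym yₗ≡) (v-adj-prev j)) (subst (λ z → Adj z _) (sym yₗ≡) (v-adj-next j))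

      xₗ-AdjB : AdjB xₗ
      xₗ-AdjB = subst AdjB (sym x≡ρr) (TracksFacts.A-AdjB tracks r∈A)

      Tracks-F0 : Tracks (F 0) v
      Tracks-F0 = proj₂ (tracked 0 (≤m'⇒<m z≤n))

      resolve-via-shortcut : ∀ {U ρ' j y} → (Σ ℕ λ ℓ → Walk (F 0) U ℓ × ℓ < m') → Tracks U ρ' → v j ∈ I →
                             Adj (ρ' j) y → y ∉ U → (∀ q → q ∈ U → q ≢ ρ' j → ¬ Adj y q) →
                             ¬ (Adj y (v (prev j)) × Adj y (v (next j))) → ⊥
      resolve-via-shortcut (_ , w , ℓ<m') = resolve-sooner w (≤m'⇒<m ℓ<m')

      -- A token z ∈ I away from B next to yₗ forces every earlier move to be external.
      Blocker : Set
      Blocker = ∃ λ z → z ∈ F 0 × ¬ AdjB z × Adj yₗ z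

      blocker? : Dec Blocker
      blocker? = any? (λ z → (z ∈? F 0) ×-dec (¬? (AdjB? z) ×-dec adj? yₗ z))

      yₗ-A-neighbour : Σ (Fin k) λ j → v j ∈ I × Adj yₗ (v j)
      yₗ-A-neighbour with y-AdjB
      ... | _ , b∈B , yₗb with ∈B⁻ b∈B
      ...   | b∉I , i , refl with adj? yₗ (v (prev i)) | adj? yₗ (v (next i))
      ...     | yes yₗ-prev | _ = prev i , ∉I⇒prev∈I b∉I , yₗ-prev
      ...     | no _ | yes yₗ-next = next i , ∉I⇒next∈I b∉I , yₗ-next
      ...     | no ¬yₗ-prev | no ¬yₗ-next = ⊥-elim (TracksFacts.claw-at-B Tracks-I b∉I (adj-sym yₗb)
                  (yₗ≢A-vertex (∉I⇒prev∈I b∉I)) (yₗ≢A-vertex (∉I⇒next∈I b∉I)) ¬yₗ-prev ¬yₗ-next)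

      tracker : (t : ℕ) (t≤m' : t ≤ m') → Tracks (F t) (proj₁ (tracked t (≤m'⇒<m t≤m')))
      tracker t t≤m' = proj₂ (tracked t (≤m'⇒<m t≤m'))

      earlier-move : ∀ t → t < m' → MoveWithin (λ q → ¬ AdjB q) t ⊎ MoveWithin AdjB t
      earlier-move t t<m' = ⊎-map (MoveWithin-map N₀⇒¬AdjB) (MoveWithin-map N₂⇒AdjB) (non-final-kind t (≤m'⇒<m t<m'))

      -- Performing only the external moves and then moving the token on v j to yₗ resolves C sooner.
      no-internal-with-blocker : Blocker → ∀ {t₀} → t₀ < m' → ¬ MoveWithin (InN G 2 B) t₀
      no-internal-with-blocker (z , z∈F0 , ¬adjB-z , yₗz) t₀<m' internal =
        resolve-via-shortcut shortcut tracks-U j∈A (adj-sym yₗvj) yₗ∉U yₗ-free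
          λ (yₗ-prev , yₗ-next) →
            two-B-neighbours-impossible (∈I⇒prev∈B j∈A) (∈I⇒next∈B j∈A) (v-next≢v-prev j ∘ sym) yₗ-prev yₗ-next
        where
          open Mix (λ q → ¬ AdjB q) (¬? ∘ AdjB?)
          open Skipping (λ q → ¬ AdjB q) (¬? ∘ AdjB?)
          U : Subset n
          U = mix (F m') (F 0)
          apart : ∀ t → t ≤ m' → ∀ a b → a ∈ F t → ¬ AdjB a → b ∈ F 0 → ¬ ¬ AdjB b → ¬ Adj a b
          apart t t≤m' a b a∈ ¬adjB-a b∈ ¬¬adjB-b =
            ¬AdjB-apart-from-AdjB (tracker t t≤m') Tracks-F0 a∈ ¬adjB-a b∈ (decidable-stable (AdjB? b) ¬¬adjB-b)
          shortcut : Σ ℕ λ ℓ → Walk (F 0) U ℓ × ℓ < m'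
          shortcut = skip-non-Z-moves (λ t → ⊎-map₂ (MoveWithin-map contradiction) ∘ earlier-move t) apart t₀<m'
                       (MoveWithin-map (contradiction ∘ N₂⇒AdjB) internal)
          j : Fin k
          j = proj₁ yₗ-A-neighbour
          j∈A : v j ∈ I
          j∈A = proj₁ (proj₂ yₗ-A-neighbour)
          yₗvj : Adj yₗ (v j)
          yₗvj = proj₂ (proj₂ yₗ-A-neighbour)
          tracks-U : Tracks U v
          tracks-U = Tracks-transfer Tracks-F0 (mix-independent (F-independent m') (F-independent 0) (apart m' ≤-refl))
            (λ adjB q∈U → [ (λ h → ⊥-elim (proj₁ h adjB)) , proj₂ ]′ (∈mix⁻ q∈U))
            (λ adjB q∈F0 → ∈mix-¬Z (λ ¬adjB → ¬adjB adjB) q∈F0)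
          yₗ∉U : yₗ ∉ U
          yₗ∉U yₗ∈U with ∈mix⁻ yₗ∈U
          ... | inj₁ (¬adjB , _) = ¬adjB y-AdjB
          ... | inj₂ (_ , yₗ∈F0) with Tracks.covers Tracks-F0 yₗ yₗ∈F0
          ...   | inj₁ (c , c∈A , yₗ≡) = yₗ≢A-vertex c∈A yₗ≡
          ...   | inj₂ ¬adjB = ¬adjB y-AdjB
          yₗ-free : ∀ q → q ∈ U → q ≢ v j → ¬ Adj yₗ q
          yₗ-free q q∈U q≢vj yₗq = [ from-F , from-F0 ]′ (∈mix⁻ q∈U)
            where
              from-F : ¬ AdjB q × q ∈ F m' → ⊥
              from-F (¬adjB-q , q∈F) = F-independent (suc m') yₗ q (proj₁ (Move-target last))
                (Move-keeps last q∈F λ q≡xₗ → ¬adjB-q (subst AdjB (sym q≡xₗ) xₗ-AdjB)) yₗq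
              vj∈F0 : v j ∈ F 0
              vj∈F0 = Tracks.A-into-S Tracks-F0 j j∈A
              from-F0 : ¬ ¬ AdjB q × q ∈ F 0 → ⊥
              from-F0 (¬¬adjB-q , q∈F0) = claw-free yₗ z (v j) q yₗz yₗvj yₗq
                (λ z≡vj → ¬adjB-z (subst AdjB (sym z≡vj) (TracksFacts.A-AdjB Tracks-F0 j∈A)))
                (λ z≡q → ¬¬adjB-q (subst (λ q' → ¬ AdjB q') z≡q ¬adjB-z)) (λ vj≡q → q≢vj (sym vj≡q))
                (F-independent 0 z (v j) z∈F0 vj∈F0) (F-independent 0 z q z∈F0 q∈F0) (F-independent 0 (v j) q vj∈F0 q∈F0)

      -- Performing only the internal moves and then the last move resolves C sooner.
      no-external-without-blocker : ¬ Blocker → ∀ {t₀} → t₀ < m' → ¬ MoveWithin (InN G 0 B) t₀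
      no-external-without-blocker no-blocker t₀<m' external =
        resolve-via-shortcut shortcut tracks-U r∈A (subst (λ z → Adj z yₗ) x≡ρr (Move-adj last)) yₗ∉U yₗ-free not-both
        where
          open Mix AdjB AdjB?
          open Skipping AdjB AdjB?
          U : Subset n
          U = mix (F m') (F 0)
          apart : ∀ t → t ≤ m' → ∀ a b → a ∈ F t → AdjB a → b ∈ F 0 → ¬ AdjB b → ¬ Adj a b
          apart t t≤m' a b a∈ adjB-a b∈ ¬adjB-b =
            ¬AdjB-apart-from-AdjB Tracks-F0 (tracker t t≤m') b∈ ¬adjB-b a∈ adjB-a ∘ adj-sym
          shortcut : Σ ℕ λ ℓ → Walk (F 0) U ℓ × ℓ < m'
          shortcut = skip-non-Z-moves (λ t → ⊎-swap ∘ earlier-move t) apart t₀<m' (MoveWithin-map N₀⇒¬AdjB external)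
          tracks-U : Tracks U ρ
          tracks-U = Tracks-transfer tracks (mix-independent (F-independent m') (F-independent 0) (apart m' ≤-refl))
            (λ adjB q∈U → [ proj₂ , (λ h → ⊥-elim (proj₁ h adjB)) ]′ (∈mix⁻ q∈U))
            (λ adjB q∈F → ∈mix-Z adjB q∈F)
          yₗ∉U : yₗ ∉ U
          yₗ∉U yₗ∈U = [ proj₂ (Move-target last) ∘ proj₂ , (λ h → proj₁ h y-AdjB) ]′ (∈mix⁻ yₗ∈U)
          yₗ-free : ∀ q → q ∈ U → q ≢ ρ r → ¬ Adj yₗ q
          yₗ-free q q∈U q≢ρr yₗq = [ from-F , from-F0 ]′ (∈mix⁻ q∈U)
            where
              from-F : AdjB q × q ∈ F m' → ⊥
              from-F (_ , q∈F) = F-independent (suc m') yₗ q (proj₁ (Move-target last))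
                (Move-keeps last q∈F λ q≡xₗ → q≢ρr (trans q≡xₗ x≡ρr)) yₗq
              from-F0 : ¬ AdjB q × q ∈ F 0 → ⊥
              from-F0 (¬adjB-q , q∈F0) = no-blocker (q , q∈F0 , ¬adjB-q , yₗq)

      internal-or-external : InternalSeq G C σ ⊎ ExternalSeq G C σ
      internal-or-external with blocker?
      ... | yes blocker = inj₂ (resolves , λ i 1+i<m → at-index i (external (toℕ i) 1+i<m))
        where
          external : ∀ t → suc t < m → MoveWithin (InN G 0 B) t
          external t 1+t<m =
            [ id , ⊥-elim ∘ no-internal-with-blocker blocker (<m⇒<m' 1+t<m) ]′ (non-final-kind t 1+t<m)
      ... | no no-blocker = inj₁ (resolves , λ i 1+i<m → at-index i (internal (toℕ i) 1+i<m))
        where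
          internal : ∀ t → suc t < m → MoveWithin (InN G 2 B) t
          internal t 1+t<m =
            [ ⊥-elim ∘ no-external-without-blocker no-blocker (<m⇒<m' 1+t<m) , id ]′ (non-final-kind t 1+t<m)

    internal-or-external : InternalSeq G C σ ⊎ ExternalSeq G C σ
    internal-or-external = by-length m refl
      where
        by-length : ∀ l → m ≡ l → InternalSeq G C σ ⊎ ExternalSeq G C σ
        by-length zero     m≡0    = ⊥-elim (proj₂ resolves
          (subst (λ S → HasCycleIn G (S ∪ B)) (trans (sym F-0) (trans (cong F (sym m≡0)) F-m)) (Tracks⇒cycle Tracks-I)))
        by-length (suc m') m≡1+m' = LastMove.internal-or-external m' m≡1+m'

lemma11 : (G : Graph) → ClawFree G → (I : Subset (Graph.n G)) → Independent G I →
          (C : BadCycle G I) → (σ : TSSeq G) → Shortest G C σ →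
          InternalSeq G C σ ⊎ ExternalSeq G C σ
lemma11 G claw-free I I-independent C σ shortest =
  ShortestResolution.internal-or-external G claw-free I-independent C σ shortest
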